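{- Let $G$ be a graph and $S$ an independent set of $G$. Let $\mathcal{M}_S$ be the collection of minimal dominating sets of $G$ that contain every vertex of $S$ and no vertex of $N(S)$. Then the subgraph of $\mathcal{R}(G)$ induced by $\mathcal{M}_S$ is isomorphic to $\mathcal{R}(G-N[S])$.
   Context: All graphs are finite, simple and undirected; $N(v)$ denotes the open neighbourhood of $v$, $N(S)$ is the set of vertices adjacent to some vertex of $S$, $N[S]=S\cup N(S)$, and $G-N[S]$ is the subgraph induced by $V(G)\setminus N[S]$. A set $D\subseteq V(G)$ is a dominating set if every vertex of $G$ is in $D$ or adjacent to a vertex of $D$; it is a minimal dominating set if no proper subset of $D$ is a dominating set. The reconfiguration graph $\mathcal{R}(G)$ has as vertex set the collection of all minimal dominating sets of $G$, and two minimal dominating sets $M_1,M_2$ are adjacent iff there is a vertex $v$ with either ($M_2\setminus M_1=\{v\}$ and $M_1\setminus M_2\subseteq N(v)$) or ($M_1\setminus M_2=\{v\}$ and $M_2\setminus M_1\subseteq N(v)$). -}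

module Defs where

open import Data.Nat using (ℕ)
open import Data.Fin using (Fin)
open import Data.Bool using (Bool; true; false; _∨_; _∧_)
open import Data.List using (allFin)
open import Data.Bool.ListAction using (any)
open import Data.Product using (Σ; _×_; _,_; proj₁)
open import Data.Sum using (_⊎_)
open import Relation.Nullary using (¬_)
open import Relation.Binary.PropositionalEquality using (_≡_)

record Graph (V : Set) : Set where
  field
    adj    : V → V → Bool
    sym    : ∀ u v → adj u v ≡ adj v u
    irrefl : ∀ v → adj v v ≡ false
open Graph public

VSet : Set → Set
VSet V = V → Bool

_∈_ : {V : Set} → V → VSet V → Set
v ∈ D = D v ≡ true

_⊆_ : {V : Set} → VSet V → VSet V → Set
D ⊆ D' = ∀ v → v ∈ D → v ∈ D'

InOpenNbhd : {V : Set} → Graph V → VSet V → V → Set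
InOpenNbhd {V} G S v = Σ V (λ u → u ∈ S × adj G u v ≡ true)

Independent : {V : Set} → Graph V → VSet V → Set
Independent G S = ∀ u v → u ∈ S → v ∈ S → adj G u v ≡ false

Dominating : {V : Set} → Graph V → VSet V → Set
Dominating {V} G D = ∀ v → v ∈ D ⊎ Σ V (λ u → u ∈ D × adj G u v ≡ true)

MinDom : {V : Set} → Graph V → VSet V → Set
MinDom {V} G D =
  Dominating G D ×
  (∀ D' → D' ⊆ D → Σ V (λ v → v ∈ D × D' v ≡ false) → ¬ Dominating G D')

RVert : {V : Set} → Graph V → Set
RVert {V} G = Σ (VSet V) (MinDom G)

Step : {V : Set} → Graph V → VSet V → VSet V → Set
Step {V} G M₁ M₂ = Σ V (λ v →
  (M₂ v ≡ true × M₁ v ≡ false) ×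
  (∀ u → M₂ u ≡ true → M₁ u ≡ false → u ≡ v) ×
  (∀ u → M₁ u ≡ true → M₂ u ≡ false → adj G v u ≡ true))

RAdj : {V : Set} → (G : Graph V) → RVert G → RVert G → Set
RAdj G M₁ M₂ = Step G (proj₁ M₁) (proj₁ M₂) ⊎ Step G (proj₁ M₂) (proj₁ M₁)

_≈R_ : {V : Set} {G : Graph V} → RVert G → RVert G → Set
_≈R_ {V} M₁ M₂ = ∀ v → proj₁ M₁ v ≡ proj₁ M₂ v

Delete : {V : Set} → Graph V → (P : V → Bool) → Graph (Σ V (λ v → P v ≡ false))
Delete G P = record
  { adj = λ u v → adj G (proj₁ u) (proj₁ v)
  ; sym = λ u v → sym G (proj₁ u) (proj₁ v)
  ; irrefl = λ v → irrefl G (proj₁ v) }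

ClosedNbhd : {n : ℕ} → Graph (Fin n) → VSet (Fin n) → VSet (Fin n)
ClosedNbhd {n} G S v = S v ∨ any (λ u → S u ∧ adj G u v) (allFin n)

DeleteClosedNbhd : {n : ℕ} → (G : Graph (Fin n)) → (S : VSet (Fin n)) →
  Graph (Σ (Fin n) (λ v → ClosedNbhd G S v ≡ false))
DeleteClosedNbhd G S = Delete G (ClosedNbhd G S)

InMS : {n : ℕ} → (G : Graph (Fin n)) → VSet (Fin n) → RVert G → Set
InMS G S M = (S ⊆ proj₁ M) × (∀ v → InOpenNbhd G S v → proj₁ M v ≡ false)

MSVert : {n : ℕ} → (G : Graph (Fin n)) → VSet (Fin n) → Set
MSVert G S = Σ (RVert G) (InMS G S)

record GraphIso {A B : Set} (_≈₁_ : A → A → Set) (_≈₂_ : B → B → Set)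
                (R₁ : A → A → Set) (R₂ : B → B → Set) : Set where
  field
    to        : A → B
    from      : B → A
    to-cong   : ∀ {a a'} → a ≈₁ a' → to a ≈₂ to a'
    from-cong : ∀ {b b'} → b ≈₂ b' → from b ≈₁ from b'
    from-to   : ∀ a → from (to a) ≈₁ a
    to-from   : ∀ b → to (from b) ≈₂ b
    adj-to    : ∀ a a' → R₁ a a' → R₂ (to a) (to a')
    adj-from  : ∀ a a' → R₂ (to a) (to a') → R₁ a a'

-- Every member M of 𝓜_S is S together with a set avoiding N[S]; independence of S
-- gives S ∩ N(S) = ∅, so S ∪ D avoids N(S) for every D ⊆ V ∖ N[S]. Restricting to
-- G − N[S] and adding S back are therefore mutually inverse, they preserve
-- domination and minimality in both directions (a dominating set avoiding N(S) must
-- contain S), and a reconfiguration step only ever touches vertices outside N[S].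
module Submission where

open import Defs hiding (sym)
open import Data.Nat using (ℕ)
open import Data.Fin using (Fin)
open import Data.Bool using (Bool; true; false; _∧_; _≟_)
open import Data.Bool.Properties using (T-≡; T-∨; T-∧; ¬-not; not-¬)
open import Data.List using (allFin)
open import Data.List.Membership.Propositional using (lose)
open import Data.List.Membership.Propositional.Properties using (∈-allFin)
open import Data.List.Relation.Unary.Any using (satisfied)
open import Data.List.Relation.Unary.Any.Properties using (any⁺; any⁻)
open import Data.Product using (Σ; _×_; _,_; proj₁; proj₂)
open import Data.Sum using (_⊎_; inj₁; inj₂; [_,_])
open import Data.Empty using (⊥; ⊥-elim)
open import Function using (_⇔_; mk⇔; Equivalence)
open import Axiom.UniquenessOfIdentityProofs using (module Decidable⇒UIP)
open import Relation.Binary.PropositionalEquality using (_≡_; refl; sym; trans; cong)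

open Equivalence using (to; from)

closedNbhd-spec : ∀ {n} (G : Graph (Fin n)) (S : VSet (Fin n)) v →
  v ∈ ClosedNbhd G S ⇔ (v ∈ S ⊎ InOpenNbhd G S v)
closedNbhd-spec {n} G S v = mk⇔ split join
  where
  adjacentFrom : Fin n → Bool
  adjacentFrom u = S u ∧ adj G u v

  split : v ∈ ClosedNbhd G S → v ∈ S ⊎ InOpenNbhd G S v
  split c with to T-∨ (from T-≡ c)
  ... | inj₁ s = inj₁ (to T-≡ s)
  ... | inj₂ a with satisfied (any⁻ adjacentFrom (allFin n) a)
  ... | u , su∧a = let su , uv = to T-∧ su∧a in inj₂ (u , to T-≡ su , to T-≡ uv)

  join : v ∈ S ⊎ InOpenNbhd G S v → v ∈ ClosedNbhd G S
  join (inj₁ s) = to T-≡ (from T-∨ (inj₁ (from T-≡ s)))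
  join (inj₂ (u , su , uv)) = to T-≡ (from T-∨ (inj₂ (any⁺ adjacentFrom
    (lose (∈-allFin u) (from T-∧ (from T-≡ su , from T-≡ uv))))))

Bool-uip : {a b : Bool} (p q : a ≡ b) → p ≡ q
Bool-uip = Decidable⇒UIP.≡-irrelevant _≟_

module ClosedNbhdDeletion {V : Set} (G : Graph V) (S : VSet V) (independent : Independent G S)
    (C : VSet V) (C-spec : ∀ v → v ∈ C ⇔ (v ∈ S ⊎ InOpenNbhd G S v)) where

  W : Set
  W = Σ V (λ v → C v ≡ false)

  H : Graph W
  H = Delete G C

  Avoids : VSet V → Set
  Avoids M = ∀ v → InOpenNbhd G S v → M v ≡ false

  Respects : VSet V → Set
  Respects M = S ⊆ M × Avoids M

  W-≡ : {w w' : W} → proj₁ w ≡ proj₁ w' → w ≡ w'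
  W-≡ {v , p} {.v , q} refl = cong (v ,_) (Bool-uip p q)

  S⇒∈C : ∀ {v} → v ∈ S → v ∈ C
  S⇒∈C s = from (C-spec _) (inj₁ s)

  N⇒∈C : ∀ {v} → InOpenNbhd G S v → v ∈ C
  N⇒∈C x = from (C-spec _) (inj₂ x)

  N⇒∉S : ∀ {v} → InOpenNbhd G S v → S v ≡ false
  N⇒∉S (u , su , uv) = ¬-not λ sv → not-¬ uv (independent u _ su sv)

  ∉C⇒∉N : ∀ {v} → C v ≡ false → InOpenNbhd G S v → ⊥
  ∉C⇒∉N c x = not-¬ (N⇒∈C x) c

  difference-outside : ∀ {M M' u} → Avoids M → S ⊆ M' → M u ≡ true → M' u ≡ false → C u ≡ false
  difference-outside avoids S⊆M' mu m'u = ¬-not λ c →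
    [ (λ s → not-¬ (S⊆M' _ s) m'u) , (λ x → not-¬ mu (avoids _ x)) ] (to (C-spec _) c)

  avoids-⊆ : ∀ {M M'} → M' ⊆ M → Avoids M → Avoids M'
  avoids-⊆ M'⊆M avoids v x = ¬-not λ m'v → not-¬ (M'⊆M v m'v) (avoids v x)

  dominating-avoiding⇒S⊆ : ∀ {M} → Avoids M → Dominating G M → S ⊆ M
  dominating-avoiding⇒S⊆ avoids dom s ss with dom s
  ... | inj₁ ms = ms
  ... | inj₂ (u , mu , us) = ⊥-elim (not-¬ mu (avoids u (s , ss , trans (Graph.sym G s u) us)))

  restrict : VSet V → VSet W
  restrict M w = M (proj₁ w)

  inside-or-outside : ∀ v → C v ≡ true ⊎ C v ≡ false
  inside-or-outside v with C v
  ... | true  = inj₁ refl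
  ... | false = inj₂ refl

  -- extend D is D ∪ S; the equation C v ≡ b supplies the membership proof of v in G − N[S].
  extendAt : VSet W → ∀ v b → C v ≡ b → Bool
  extendAt D v true  _ = S v
  extendAt D v false p = D (v , p)

  extend : VSet W → VSet V
  extend D v = extendAt D v (C v) refl

  extend-outside : ∀ D {v} (p : C v ≡ false) → extend D v ≡ D (v , p)
  extend-outside D {v} p = go (C v) refl
    where
    go : ∀ b (e : C v ≡ b) → extendAt D v b e ≡ D (v , p)
    go true  e = ⊥-elim (not-¬ e p)
    go false e = cong (λ q → D (v , q)) (Bool-uip e p)

  extend-inside : ∀ D {v} → C v ≡ true → extend D v ≡ S v
  extend-inside D {v} c = go (C v) refl
    where
    go : ∀ b (e : C v ≡ b) → extendAt D v b e ≡ S v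
    go true  e = refl
    go false e = ⊥-elim (not-¬ c e)

  extend-respects : ∀ D → Respects (extend D)
  extend-respects D = (λ v s → trans (extend-inside D (S⇒∈C s)) s)
                    , (λ v x → trans (extend-inside D (N⇒∈C x)) (N⇒∉S x))

  extend-⊆ : ∀ {D M} → S ⊆ M → D ⊆ restrict M → extend D ⊆ M
  extend-⊆ {D} S⊆M D⊆M v e with inside-or-outside v
  ... | inj₁ c = S⊆M v (trans (sym (extend-inside D c)) e)
  ... | inj₂ c = D⊆M (v , c) (trans (sym (extend-outside D c)) e)

  restrict-⊆ : ∀ {D M} → M ⊆ extend D → restrict M ⊆ D
  restrict-⊆ {D} M⊆ (v , p) e = trans (sym (extend-outside D p)) (M⊆ v e)

  extend-restrict : ∀ {M} → Respects M → ∀ v → extend (restrict M) v ≡ M v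
  extend-restrict {M} (S⊆M , avoids) v with inside-or-outside v
  ... | inj₂ c = extend-outside (restrict M) c
  ... | inj₁ c with to (C-spec v) c
  ...   | inj₁ s = trans (extend-inside _ c) (trans s (sym (S⊆M v s)))
  ...   | inj₂ x = trans (extend-inside _ c) (trans (N⇒∉S x) (sym (avoids v x)))

  extend-cong : ∀ {D D'} → (∀ w → D w ≡ D' w) → ∀ v → extend D v ≡ extend D' v
  extend-cong {D} {D'} D≡D' v with inside-or-outside v
  ... | inj₁ c = trans (extend-inside D c) (sym (extend-inside D' c))
  ... | inj₂ c = trans (extend-outside D c) (trans (D≡D' (v , c)) (sym (extend-outside D' c)))

  extend-dominating : ∀ {D} → Dominating H D → Dominating G (extend D)
  extend-dominating {D} dom v with inside-or-outside v
  ... | inj₁ c with to (C-spec v) c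
  ...   | inj₁ s = inj₁ (trans (extend-inside D c) s)
  ...   | inj₂ (u , su , uv) = inj₂ (u , trans (extend-inside D (S⇒∈C su)) su , uv)
  extend-dominating {D} dom v | inj₂ c with dom (v , c)
  ...   | inj₁ d = inj₁ (trans (extend-outside D c) d)
  ...   | inj₂ ((u , q) , du , uv) = inj₂ (u , trans (extend-outside D q) du , uv)

  -- A vertex outside N[S] cannot be dominated from S, nor from N(S) since M avoids it.
  restrict-dominating : ∀ {M} → Avoids M → Dominating G M → Dominating H (restrict M)
  restrict-dominating avoids dom (v , p) with dom v
  ... | inj₁ mv = inj₁ mv
  ... | inj₂ (u , mu , uv) = inj₂ ((u , outside) , mu , uv)
    where
    outside : C u ≡ false
    outside = ¬-not λ c →
      [ (λ su → ∉C⇒∉N p (u , su , uv)) , (λ x → not-¬ mu (avoids u x)) ] (to (C-spec u) c)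

  extend-minimal : ∀ {D} → MinDom H D → MinDom G (extend D)
  extend-minimal {D} (dom , minimal) =
    extend-dominating dom , λ { M' M'⊆ (v , ev , m'v) domM' →
      excluded M'⊆ (avoids-⊆ M'⊆ (proj₂ (extend-respects D))) ev m'v domM' }
    where
    excluded : ∀ {M' v} → M' ⊆ extend D → Avoids M' →
      extend D v ≡ true → M' v ≡ false → Dominating G M' → ⊥
    excluded {M'} {v} M'⊆ avoids ev m'v domM' with inside-or-outside v
    ... | inj₁ c = not-¬ (dominating-avoiding⇒S⊆ avoids domM' v (trans (sym (extend-inside D c)) ev)) m'v
    ... | inj₂ c = minimal (restrict M') (restrict-⊆ M'⊆)
      ((v , c) , trans (sym (extend-outside D c)) ev , m'v)
      (restrict-dominating avoids domM')

  restrict-minimal : ∀ {M} → Respects M → MinDom G M → MinDom H (restrict M)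
  restrict-minimal (S⊆M , avoids) (dom , minimal) =
    restrict-dominating avoids dom ,
    λ { D' D'⊆ ((v , p) , mv , d'v) domD' →
        minimal (extend D') (extend-⊆ S⊆M D'⊆) (v , mv , trans (extend-outside D' p) d'v)
                (extend-dominating domD') }

  restrict-step : ∀ {M₁ M₂} → Respects M₁ → Respects M₂ →
    Step G M₁ M₂ → Step H (restrict M₁) (restrict M₂)
  restrict-step (S⊆M₁ , _) (_ , avoids₂) (v , (m₂v , m₁v) , added , removed) =
    (v , difference-outside avoids₂ S⊆M₁ m₂v m₁v) , (m₂v , m₁v) ,
    (λ u m₂u m₁u → W-≡ (added (proj₁ u) m₂u m₁u)) , (λ u → removed (proj₁ u))

  extend-step : ∀ {M₁ M₂} → Respects M₁ → Respects M₂ →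
    Step H (restrict M₁) (restrict M₂) → Step G M₁ M₂
  extend-step (S⊆M₁ , avoids₁) (S⊆M₂ , avoids₂) ((v , _) , (m₂v , m₁v) , added , removed) =
    v , (m₂v , m₁v) ,
    (λ u m₂u m₁u → cong proj₁ (added (u , difference-outside avoids₂ S⊆M₁ m₂u m₁u) m₂u m₁u)) ,
    (λ u m₁u m₂u → removed (u , difference-outside avoids₁ S⊆M₂ m₁u m₂u) m₁u m₂u)

  𝓜S : Set
  𝓜S = Σ (RVert G) (λ M → Respects (proj₁ M))

  restrictR : 𝓜S → RVert H
  restrictR ((M , minM) , respects) = restrict M , restrict-minimal respects minM

  extendR : RVert H → 𝓜S
  extendR (D , minD) = (extend D , extend-minimal minD) , extend-respects D

  𝓜S≅R : GraphIso {𝓜S} {RVert H}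
      (λ M₁ M₂ → _≈R_ {G = G} (proj₁ M₁) (proj₁ M₂))
      (λ D₁ D₂ → _≈R_ {G = H} D₁ D₂)
      (λ M₁ M₂ → RAdj G (proj₁ M₁) (proj₁ M₂))
      (RAdj H)
  𝓜S≅R = record
    { to        = restrictR
    ; from      = extendR
    ; to-cong   = λ M₁≈M₂ w → M₁≈M₂ (proj₁ w)
    ; from-cong = extend-cong
    ; from-to   = λ M → extend-restrict (proj₂ M)
    ; to-from   = λ D w → extend-outside (proj₁ D) (proj₂ w)
    ; adj-to    = λ { (_ , r₁) (_ , r₂) (inj₁ s) → inj₁ (restrict-step r₁ r₂ s)
                    ; (_ , r₁) (_ , r₂) (inj₂ s) → inj₂ (restrict-step r₂ r₁ s) }
    ; adj-from  = λ { (_ , r₁) (_ , r₂) (inj₁ s) → inj₁ (extend-step r₁ r₂ s)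
                    ; (_ , r₁) (_ , r₂) (inj₂ s) → inj₂ (extend-step r₂ r₁ s) }
    }

lemma1 : (n : ℕ) (G : Graph (Fin n)) (S : VSet (Fin n)) → Independent G S →
    GraphIso {MSVert G S} {RVert (DeleteClosedNbhd G S)}
      (λ M₁ M₂ → _≈R_ {G = G} (proj₁ M₁) (proj₁ M₂))
      (λ M₁ M₂ → _≈R_ {G = DeleteClosedNbhd G S} M₁ M₂)
      (λ M₁ M₂ → RAdj G (proj₁ M₁) (proj₁ M₂))
      (RAdj (DeleteClosedNbhd G S))
lemma1 n G S independent =
  ClosedNbhdDeletion.𝓜S≅R G S independent (ClosedNbhd G S) (closedNbhd-spec G S)
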